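{- Let $G$ be a connected graph that is not $K_1$. For every vertex $v\in V(G)$ there exists a vertex $x\neq v$ of $G$ (joined to $v$ by a nontrivial path) such that $\mathrm{cat}(G,x)\geq \mathrm{cat}(G,v)-1$.
   Context: Cat Herding is a two-player game on a finite simple graph $G$ between a cat and a herder. First the cat places its token on a starting vertex. Then the players alternate, the herder moving first: on the herder's turn it deletes one edge of the current graph (a "cut"); on the cat's turn the cat must move its token along a path of the current graph to a different vertex. The game ends when the cat's current vertex has no incident edges. The score is the total number of edges deleted; the herder minimizes and the cat maximizes it. For $v\in V(G)$, $\mathrm{cat}(G,v)$ is the optimal-play score when the cat starts at $v$. -}

module Defs where

open import Data.Nat using (ℕ; zero; suc; _+_; _⊓_; _⊔_)
open import Data.Bool using (Bool; true; false; _∧_; _∨_; not; if_then_else_; T)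
open import Data.Fin using (Fin; _≟_; _<?_)
open import Data.List using (List; []; _∷_; [_]; map; foldr; concatMap; length; allFin)
open import Data.Bool.ListAction using (any; all)
open import Data.Product using (_×_; _,_)
open import Relation.Nullary.Decidable using (⌊_⌋)
open import Relation.Binary.PropositionalEquality using (_≡_)

record SimpleGraph (n : ℕ) : Set where
  field
    adj    : Fin n → Fin n → Bool
    sym    : ∀ u w → adj u w ≡ adj w u
    irrefl : ∀ u → adj u u ≡ false
open SimpleGraph public

Edge : ℕ → Set
Edge n = Fin n × Fin n

edges : ∀ {n} → SimpleGraph n → List (Edge n)
edges {n} G = concatMap (λ i → concatMap (λ j →
  if ⌊ i <? j ⌋ ∧ adj G i j then [ (i , j) ] else []) (allFin n)) (allFin n)

module _ {n : ℕ} where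

  _==_ : Fin n → Fin n → Bool
  a == b = ⌊ a ≟ b ⌋

  adjE : List (Edge n) → Fin n → Fin n → Bool
  adjE E a b = any (λ { (x , y) → (x == a ∧ y == b) ∨ (x == b ∧ y == a) }) E

  reachWithin : ℕ → List (Edge n) → Fin n → Fin n → Bool
  reachWithin zero    E a b = a == b
  reachWithin (suc k) E a b = (a == b) ∨ any (λ c → adjE E a c ∧ reachWithin k E c b) (allFin n)

  -- a and b lie in the same component (a path exists iff a walk of length ≤ n exists)
  reach : List (Edge n) → Fin n → Fin n → Bool
  reach E a b = reachWithin n E a b

  isolated : List (Edge n) → Fin n → Bool
  isolated E v = all (λ { (x , y) → not (x == v ∨ y == v) }) E

picks : ∀ {A : Set} → List A → List (A × List A)
picks []       = []
picks (x ∷ xs) = (x , xs) ∷ map (λ { (y , ys) → (y , x ∷ ys) }) (picks xs)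

minimumL : List ℕ → ℕ
minimumL []       = 0
minimumL (x ∷ xs) = foldr _⊓_ x xs

maximumL : List ℕ → ℕ
maximumL = foldr _⊔_ 0

module _ {n : ℕ} where
  mutual
    -- herder to move, cat at v, current edge list E (fuel ≥ |E| + 1)
    herderVal : ℕ → List (Edge n) → Fin n → ℕ
    herderVal zero    E v = 0
    herderVal (suc f) E v =
      if isolated E v then 0
      else minimumL (map (λ { (e , rest) → suc (catVal f rest v) }) (picks E))

    catVal : ℕ → List (Edge n) → Fin n → ℕ
    catVal f E v =
      if isolated E v then 0
      else maximumL (map (λ w → if not (w == v) ∧ reach E v w then herderVal f E w else 0)
                         (allFin n))

-- cat(G, v): optimal score when the cat starts at v (herder moves first)
cat : ∀ {n} → SimpleGraph n → Fin n → ℕ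
cat G v = herderVal (suc (length (edges G))) (edges G) v

Connected : ∀ {n} → SimpleGraph n → Set
Connected G = ∀ u w → T (reach (edges G) u w)

{-# OPTIONS --safe #-}
-- The herder may open by cutting the first edge e, so cat(G, v) is at most one more than
-- the value of the cat's move from v in G − e.  The cat's best move there goes to some
-- x ≠ v, and since removing edges (or fuel) can only lower the cat's score, the value
-- reached at x in G − e is at most cat(G, x).  Connectivity supplies the path from v to x.
module Submission where

open import Defs
open import Data.Nat using (ℕ; zero; suc; _≤_; _≥_; _∸_; z≤n; s≤s; _⊓_)
open import Data.Nat.Properties
  using ( ≤-refl; ≤-reflexive; ≤-trans; m⊓n≤m; m⊓n≤n; ⊓-glb; ⊔-sel; ⊔-mono-≤; ∸-monoˡ-≤; n≤1+n
        ; module ≤-Reasoning)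
open import Data.Fin using (Fin; zero; punchIn)
open import Data.Fin.Properties using (punchInᵢ≢i)
open import Data.Bool using (Bool; true; false; T; _∧_; _∨_; not; if_then_else_)
open import Data.Bool.Properties using (T-∧; T-∨)
open import Data.Bool.ListAction using (any; all)
open import Data.List using (List; []; _∷_; map; foldr; allFin; length)
open import Data.List.Properties using (foldr-preservesᵇ)
open import Data.List.Membership.Propositional using (_∈_)
open import Data.List.Membership.Propositional.Properties using (∈-map⁺; ∈-map⁻; foldr-selective)
open import Data.List.Relation.Unary.Any as Any using (here; there)
open import Data.List.Relation.Unary.Any.Properties using (any⁺; any⁻)
open import Data.List.Relation.Unary.All as All using (All; _∷_)
open import Data.List.Relation.Unary.All.Properties using (all⁺; all⁻; map⁺)
open import Data.List.Relation.Binary.Sublist.Propositional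
  using (_⊆_; []; _∷_; _∷ʳ_; ⊆-refl; minimum)
open import Data.List.Relation.Binary.Sublist.Propositional.Properties
  using (Any-resp-⊆; All-resp-⊆; ∷ˡ⁻)
open import Data.Product as Product using (∃-syntax; _×_; _,_; proj₁)
open import Data.Sum as Sum using (_⊎_; inj₁; inj₂)
open import Data.Empty using (⊥-elim)
open import Function using (_∘_; id; Equivalence)
open import Relation.Nullary.Decidable using (toWitnessFalse)
open import Relation.Binary.PropositionalEquality as ≡ using (_≡_; _≢_; refl; subst)

T-∧-map : ∀ {a b c d} → (T a → T c) → (T b → T d) → T (a ∧ b) → T (c ∧ d)
T-∧-map f g = Equivalence.from T-∧ ∘ Product.map f g ∘ Equivalence.to T-∧

T-∨-map : ∀ {a b c d} → (T a → T c) → (T b → T d) → T (a ∨ b) → T (c ∨ d)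
T-∨-map f g = Equivalence.from T-∨ ∘ Sum.map f g ∘ Equivalence.to T-∨

any-mono : ∀ {A : Set} {p q : A → Bool} → (∀ {x} → T (p x) → T (q x)) →
           ∀ xs → T (any p xs) → T (any q xs)
any-mono {p = p} {q} p⇒q xs = any⁺ q ∘ Any.map p⇒q ∘ any⁻ p xs

any-resp-⊆ : ∀ {A : Set} (p : A → Bool) {xs ys} → xs ⊆ ys → T (any p xs) → T (any p ys)
any-resp-⊆ p xs⊆ys = any⁺ p ∘ Any-resp-⊆ xs⊆ys ∘ any⁻ p _

all-resp-⊇ : ∀ {A : Set} (p : A → Bool) {xs ys} → xs ⊆ ys → T (all p ys) → T (all p xs)
all-resp-⊇ p xs⊆ys = all⁻ p ∘ All-resp-⊆ xs⊆ys ∘ all⁺ p _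

if-then-0-≤ : ∀ b {m} → (if b then 0 else m) ≤ m
if-then-0-≤ true  = z≤n
if-then-0-≤ false = ≤-refl

if-then-0-≡0 : ∀ {b m} → T b → (if b then 0 else m) ≡ 0
if-then-0-≡0 {true} _ = refl

≤-if-then-0 : ∀ b {k m} → (T b → k ≡ 0) → k ≤ m → k ≤ (if b then 0 else m)
≤-if-then-0 true  k≡0 _   = ≤-reflexive (k≡0 _)
≤-if-then-0 false _   k≤m = k≤m

if-else-0-mono : ∀ {c′ c m′ m} → (T c′ → T c) → m′ ≤ m →
                 (if c′ then m′ else 0) ≤ (if c then m else 0)
if-else-0-mono {false}           _    _     = z≤n
if-else-0-mono {true}  {true}    _    m′≤m  = m′≤m
if-else-0-mono {true}  {false}   c′⇒c _     = ⊥-elim (c′⇒c _)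

if-else-0-elim : ∀ (P : ℕ → Set) c {m} → (T c → P m) → P 0 → P (if c then m else 0)
if-else-0-elim P true  Pm _  = Pm _
if-else-0-elim P false _  P0 = P0

foldr-⊓-≤-seed : ∀ a ms → foldr _⊓_ a ms ≤ a
foldr-⊓-≤-seed a []       = ≤-refl
foldr-⊓-≤-seed a (m ∷ ms) = ≤-trans (m⊓n≤n m _) (foldr-⊓-≤-seed a ms)

foldr-⊓-≤ : ∀ a {ms m} → m ∈ ms → foldr _⊓_ a ms ≤ m
foldr-⊓-≤ a (here refl) = m⊓n≤m _ _
foldr-⊓-≤ a (there m∈)  = ≤-trans (m⊓n≤n _ _) (foldr-⊓-≤ a m∈)

minimumL-≤ : ∀ {ms m} → m ∈ ms → minimumL ms ≤ m
minimumL-≤ {a ∷ ms} (here refl) = foldr-⊓-≤-seed a ms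
minimumL-≤ {a ∷ _} (there m∈)  = foldr-⊓-≤ a m∈

≤-minimumL : ∀ {k m ms} → All (k ≤_) (m ∷ ms) → k ≤ minimumL (m ∷ ms)
≤-minimumL {k} (k≤m ∷ k≤ms) = foldr-preservesᵇ {P = k ≤_} ⊓-glb k≤m k≤ms

maximumL-attained : ∀ ms → maximumL ms ≡ 0 ⊎ maximumL ms ∈ ms
maximumL-attained = foldr-selective ⊔-sel 0

maximumL-map-mono : ∀ {A : Set} {g′ g : A → ℕ} → (∀ x → g′ x ≤ g x) →
                    ∀ xs → maximumL (map g′ xs) ≤ maximumL (map g xs)
maximumL-map-mono g′≤g []       = z≤n
maximumL-map-mono g′≤g (x ∷ xs) = ⊔-mono-≤ (g′≤g x) (maximumL-map-mono g′≤g xs)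

-- The herder on the smaller edge set can answer every cut on the larger one with a cut leaving
-- fewer edges behind.
picks-⊆ : ∀ {A : Set} {x : A} {xs ys e rest} → x ∷ xs ⊆ ys → (e , rest) ∈ picks ys →
          ∃[ e′ ] ∃[ rest′ ] ((e′ , rest′) ∈ picks (x ∷ xs) × rest′ ⊆ rest)
picks-⊆ (y ∷ʳ sub) (here refl) = _ , _ , here refl , ∷ˡ⁻ sub
picks-⊆ (y ∷ʳ sub) (there cut∈) with ∈-map⁻ _ cut∈
... | (e , rest) , cut∈′ , refl with picks-⊆ sub cut∈′
...   | e′ , rest′ , cut′∈ , rest′⊆rest = e′ , rest′ , cut′∈ , y ∷ʳ rest′⊆rest
picks-⊆ (refl ∷ sub) (here refl) = _ , _ , here refl , sub
picks-⊆ {xs = []} (refl ∷ sub) (there _) = _ , [] , here refl , minimum _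
picks-⊆ {xs = _ ∷ _} (refl ∷ sub) (there cut∈) with ∈-map⁻ _ cut∈
... | (e , rest) , cut∈′ , refl with picks-⊆ sub cut∈′
...   | e′ , rest′ , cut′∈ , rest′⊆rest = e′ , _ ∷ rest′ , there (∈-map⁺ _ cut′∈) , refl ∷ rest′⊆rest

other-vertex : ∀ {n} → 2 ≤ n → (v : Fin n) → ∃[ x ] x ≢ v
other-vertex (s≤s (s≤s _)) v = punchIn v zero , punchInᵢ≢i v zero

module _ {n : ℕ} where

  module _ {E′ E : List (Edge n)} (E′⊆E : E′ ⊆ E) where

    isolated-anti-mono : ∀ v → T (isolated E v) → T (isolated E′ v)
    isolated-anti-mono v = all-resp-⊇ _ E′⊆E

    adjE-mono : ∀ {a b} → T (adjE E′ a b) → T (adjE E a b)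
    adjE-mono = any-resp-⊆ _ E′⊆E

    reachWithin-mono : ∀ k {a b} → T (reachWithin k E′ a b) → T (reachWithin k E a b)
    reachWithin-mono zero    = id
    reachWithin-mono (suc k) =
      T-∨-map id (any-mono (T-∧-map adjE-mono (reachWithin-mono k)) (allFin n))

    reach-mono : ∀ a b → T (reach E′ a b) → T (reach E a b)
    reach-mono a b = reachWithin-mono n

  herderVal-isolated : ∀ {f} {E : List (Edge n)} {v} → T (isolated E v) → herderVal f E v ≡ 0
  herderVal-isolated {zero}  _   = refl
  herderVal-isolated {suc f} iso = if-then-0-≡0 iso

  catVal-isolated : ∀ {f} {E : List (Edge n)} {v} → T (isolated E v) → catVal f E v ≡ 0
  catVal-isolated iso = if-then-0-≡0 iso

  herderVal-cut : ∀ f (E : List (Edge n)) v {e rest} → (e , rest) ∈ picks E →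
                  herderVal (suc f) E v ≤ suc (catVal f rest v)
  herderVal-cut f E v cut∈ = ≤-trans (if-then-0-≤ (isolated E v)) (minimumL-≤ (∈-map⁺ _ cut∈))

  mutual
    herderVal-mono : ∀ {f′ f} {E′ E : List (Edge n)} → f′ ≤ f → E′ ⊆ E → ∀ v →
                     herderVal f′ E′ v ≤ herderVal f E v
    herderVal-mono z≤n _ _ = z≤n
    herderVal-mono {E′ = []} (s≤s _) _ _ = z≤n
    herderVal-mono {E′ = _ ∷ _} {E = []} _ () _
    herderVal-mono {suc f′} {suc f} {E′@(_ ∷ _)} {E@(_ ∷ _)} (s≤s f′≤f) E′⊆E v =
      ≤-if-then-0 (isolated E v)
        (herderVal-isolated {suc f′} {E′} ∘ isolated-anti-mono E′⊆E v)
        (≤-minimumL (map⁺ (All.tabulate {xs = picks E} λ { {e , rest} → answer })))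
      where
      answer : ∀ {e rest} → (e , rest) ∈ picks E →
               herderVal (suc f′) E′ v ≤ suc (catVal f rest v)
      answer cut∈ with picks-⊆ E′⊆E cut∈
      ... | _ , _ , cut′∈ , rest′⊆rest =
        ≤-trans (herderVal-cut f′ E′ v cut′∈) (s≤s (catVal-mono f′≤f rest′⊆rest v))

    catVal-mono : ∀ {f′ f} {E′ E : List (Edge n)} → f′ ≤ f → E′ ⊆ E → ∀ v →
                  catVal f′ E′ v ≤ catVal f E v
    catVal-mono {f′} {f} {E′} {E} f′≤f E′⊆E v =
      ≤-if-then-0 (isolated E v)
        (catVal-isolated {f′} {E′} ∘ isolated-anti-mono E′⊆E v)
        (≤-trans (if-then-0-≤ (isolated E′ v))
          (maximumL-map-mono
            (λ w → if-else-0-mono (T-∧-map id (reach-mono E′⊆E v w)) (herderVal-mono f′≤f E′⊆E w))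
            (allFin n)))

  catVal-bestReply : ∀ f (E : List (Edge n)) v {x₀} → x₀ ≢ v →
                     ∃[ x ] (x ≢ v × catVal f E v ≤ herderVal f E x)
  catVal-bestReply f E v {x₀} x₀≢v =
    let x , x≢v , best≤ = maximum-dominated (maximumL-attained replies)
    in  x , x≢v , ≤-trans (if-then-0-≤ (isolated E v)) best≤
    where
    Dominated : ℕ → Set
    Dominated k = ∃[ x ] (x ≢ v × k ≤ herderVal f E x)

    fallback : Dominated 0
    fallback = x₀ , x₀≢v , z≤n

    reply : Fin n → ℕ
    reply w = if not (w == v) ∧ reach E v w then herderVal f E w else 0

    replies : List ℕ
    replies = map reply (allFin n)

    move : ∀ w → Dominated (reply w)
    move w = if-else-0-elim Dominated (not (w == v) ∧ reach E v w)
      (λ legal → w , toWitnessFalse (proj₁ (Equivalence.to (T-∧ {not (w == v)}) legal)) , ≤-refl)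
      fallback

    maximum-dominated : maximumL replies ≡ 0 ⊎ maximumL replies ∈ replies →
                        Dominated (maximumL replies)
    maximum-dominated (inj₁ max≡0) = subst Dominated (≡.sym max≡0) fallback
    maximum-dominated (inj₂ max∈) with ∈-map⁻ reply max∈
    ... | w , _ , max≡reply = subst Dominated (≡.sym max≡reply) (move w)

  herderVal-≥-pred-elsewhere : ∀ f (E : List (Edge n)) v {x₀} → x₀ ≢ v →
                               ∃[ x ] (x ≢ v × herderVal f E x ≥ herderVal f E v ∸ 1)
  herderVal-≥-pred-elsewhere zero    E            v x₀≢v = _ , x₀≢v , z≤n
  herderVal-≥-pred-elsewhere (suc f) []           v x₀≢v = _ , x₀≢v , z≤n
  herderVal-≥-pred-elsewhere (suc f) E@(e ∷ rest) v x₀≢v =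
    let x , x≢v , reply≤ = catVal-bestReply f rest v x₀≢v
    in  x , x≢v , (begin
      herderVal (suc f) E v ∸ 1  ≤⟨ ∸-monoˡ-≤ 1 (herderVal-cut f E v (here refl)) ⟩
      catVal f rest v            ≤⟨ reply≤ ⟩
      herderVal f rest x         ≤⟨ herderVal-mono (n≤1+n f) (e ∷ʳ ⊆-refl) x ⟩
      herderVal (suc f) E x      ∎)
    where open ≤-Reasoning

mainTheorem14 : ∀ {n} (G : SimpleGraph n) → 2 ≤ n → Connected G →
    ∀ (v : Fin n) → ∃[ x ] (x ≢ v × T (reach (edges G) v x) × cat G x ≥ cat G v ∸ 1)
mainTheorem14 G 2≤n connected v =
  let _ , x₀≢v      = other-vertex 2≤n v
      x , x≢v , bound = herderVal-≥-pred-elsewhere (suc (length (edges G))) (edges G) v x₀≢v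
  in  x , x≢v , connected v x , bound
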